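{- For all integers $n,m\ge0$, let $\underline{n}:=Y_n$ denote the total grove of degree $n$. Then $\underline{n}+\underline{m}=\underline{n+m}$; that is, the multiset union of the sets $x+y$ over all $x\in Y_n$, $y\in Y_m$ is exactly $Y_{n+m}$, each tree of $Y_{n+m}$ occurring exactly once.
   Context: A planar binary tree of degree $n\ge 0$ is a planar rooted tree (up to planar isotopy) with $n+1$ leaves in which every internal vertex has exactly two inputs; $Y_n$ is the set of these trees, $Y_0=\{|\}$. For $x\in Y_p$, $y\in Y_q$ the grafting $x\vee y\in Y_{p+q+1}$ joins the roots of $x$ and $y$ to a new vertex with a new root; every $x\in Y_n$, $n\ge1$, decomposes uniquely as $x=x^l\vee x^r$. Each $Y_n$ carries the (Tamari) partial order: the smallest partial order such that $(a\vee b)\vee c\le a\vee(b\vee c)$ for all trees $a,b,c$, and $a\le b$ implies $a\vee c\le b\vee c$ and $c\vee a\le c\vee b$. For $x\in Y_p,y\in Y_q$, $x/y\in Y_{p+q}$ is obtained by identifying the root of $x$ with the leftmost leaf of $y$, and $x\backslash y\in Y_{p+q}$ by identifying the rightmost leaf of $x$ with the root of $y$ (recursively: $x/|=x$, $x/(y^l\vee y^r)=(x/y^l)\vee y^r$, $|\backslash y=y$, $(x^l\vee x^r)\backslash y=x^l\vee(x^r\backslash y)$). The sum of trees is $x+y:=\{z\in Y_{p+q}: x/y\le z\le x\backslash y\}$. A grove is a nonempty subset of some $Y_n$; the sum of groves $A+B$ is the multiset union of the $a+b$, $a\in A,b\in B$. -}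

module Defs where

open import Data.Nat using (ℕ; zero; suc; _+_)
open import Data.Product using (_×_)
open import Relation.Binary.PropositionalEquality using (_≡_)

-- Planar binary trees; `leaf` is the tree | of degree 0,
-- `x ∨ y` is the grafting of x and y.
data Tree : Set where
  leaf : Tree
  _∨_  : Tree → Tree → Tree

infixr 5 _∨_

-- degree = number of internal vertices (= number of leaves − 1)
degree : Tree → ℕ
degree leaf    = zero
degree (x ∨ y) = suc (degree x + degree y)

Y : ℕ → Tree → Set
Y n x = degree x ≡ n

data _≤T_ : Tree → Tree → Set where
  rot    : ∀ a b c → ((a ∨ b) ∨ c) ≤T (a ∨ (b ∨ c))
  congˡ  : ∀ {a b} c → a ≤T b → (a ∨ c) ≤T (b ∨ c)
  congʳ  : ∀ {a b} c → a ≤T b → (c ∨ a) ≤T (c ∨ b)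
  refl≤  : ∀ a → a ≤T a
  trans≤ : ∀ {a b c} → a ≤T b → b ≤T c → a ≤T c

infix 4 _≤T_

-- x / y : root of x identified with the leftmost leaf of y
_/_ : Tree → Tree → Tree
x / leaf    = x
x / (l ∨ r) = (x / l) ∨ r

-- x \ y : rightmost leaf of x identified with the root of y
_\\_ : Tree → Tree → Tree
leaf    \\ y = y
(l ∨ r) \\ y = l ∨ (r \\ y)

_∈Sum_,_ : Tree → Tree → Tree → Set
z ∈Sum x , y = ((x / y) ≤T z) × (z ≤T (x \\ y))

-- A tree z of degree n + m is cut at its n-th leaf into a pair (x , y) of degrees n and m,
-- and z lies between x / y and x \\ y.  Cutting at a fixed leaf is monotone for the Tamari
-- order and sends both x / y and x \\ y back to (x , y), so by antisymmetry any x , y with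
-- z ∈ x + y are the pieces of the cut.  Antisymmetry holds because every rotation strictly
-- increases the sum over internal vertices of the degree of the right subtree.
module Submission where

open import Defs
open import Data.Nat using (ℕ; zero; suc; _+_; _≤_; _<_; z≤n; s≤s; s≤s⁻¹)
open import Data.Nat.Properties
open import Data.Nat.Tactic.RingSolver using (solve-∀)
open import Data.Product using (Σ; _×_; _,_; proj₁; proj₂; map₁; map₂)
open import Data.Product.Properties using (,-injective)
open import Data.Product.Relation.Binary.Pointwise.NonDependent
  using (Pointwise; ×-antisymmetric; ≡×≡⇒≡)
open import Data.Sum using (_⊎_; inj₁; inj₂)
open import Data.Empty using (⊥-elim)
open import Relation.Binary.PropositionalEquality
  using (_≡_; refl; sym; trans; cong; subst; module ≡-Reasoning)

≤T-degree : ∀ {a b} → a ≤T b → degree a ≡ degree b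
≤T-degree (rot a b c)  = cong suc (trans (cong suc (+-assoc (degree a) (degree b) (degree c)))
                                         (sym (+-suc (degree a) (degree b + degree c))))
≤T-degree (congˡ c p)  = cong (λ d → suc (d + degree c)) (≤T-degree p)
≤T-degree (congʳ c p)  = cong (λ d → suc (degree c + d)) (≤T-degree p)
≤T-degree (refl≤ a)    = refl
≤T-degree (trans≤ p q) = trans (≤T-degree p) (≤T-degree q)

rightWeight : Tree → ℕ
rightWeight leaf    = 0
rightWeight (l ∨ r) = rightWeight l + rightWeight r + degree r

rightWeight-rot : ∀ a b c → rightWeight (a ∨ (b ∨ c)) ≡ suc (rightWeight ((a ∨ b) ∨ c) + degree c)
rightWeight-rot a b c = lemma (rightWeight a) (rightWeight b) (rightWeight c) (degree b) (degree c)
  where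
  lemma : ∀ wa wb wc db dc → wa + (wb + wc + dc) + suc (db + dc) ≡ suc (wa + wb + db + wc + dc + dc)
  lemma = solve-∀

≤T-rightWeight : ∀ {a b} → a ≤T b → a ≡ b ⊎ rightWeight a < rightWeight b
≤T-rightWeight (rot a b c) rewrite rightWeight-rot a b c = inj₂ (s≤s (m≤m+n _ (degree c)))
≤T-rightWeight (congˡ c p) with ≤T-rightWeight p
... | inj₁ refl = inj₁ refl
... | inj₂ q    = inj₂ (+-monoˡ-< (degree c) (+-monoˡ-< (rightWeight c) q))
≤T-rightWeight (congʳ c p) with ≤T-rightWeight p | ≤T-degree p
... | inj₁ refl | _ = inj₁ refl
... | inj₂ q | eq   = inj₂ (subst (λ d → _ < rightWeight c + _ + d) eq
                             (+-monoˡ-< _ (+-monoʳ-< (rightWeight c) q)))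
≤T-rightWeight (refl≤ a) = inj₁ refl
≤T-rightWeight (trans≤ p q) with ≤T-rightWeight p | ≤T-rightWeight q
... | inj₁ refl | r        = r
... | inj₂ r    | inj₁ refl = inj₂ r
... | inj₂ r    | inj₂ s    = inj₂ (<-trans r s)

≤T-antisym : ∀ {a b} → a ≤T b → b ≤T a → a ≡ b
≤T-antisym p q with ≤T-rightWeight p | ≤T-rightWeight q
... | inj₁ eq | _       = eq
... | inj₂ _  | inj₁ eq = sym eq
... | inj₂ r  | inj₂ s  = ⊥-elim (<-asym r s)

\\-∨-≤T : ∀ a b c → (a \\ b) ∨ c ≤T a \\ (b ∨ c)
\\-∨-≤T leaf    b c = refl≤ _
\\-∨-≤T (p ∨ q) b c = trans≤ (rot p (q \\ b) c) (congʳ p (\\-∨-≤T q b c))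

∨-/-≤T : ∀ a b c → (a ∨ b) / c ≤T a ∨ (b / c)
∨-/-≤T a b leaf    = refl≤ _
∨-/-≤T a b (p ∨ q) = trans≤ (congˡ q (∨-/-≤T a b p)) (rot a (b / p) q)

degree-/ : ∀ x y → degree (x / y) ≡ degree x + degree y
degree-/ x leaf    = sym (+-identityʳ (degree x))
degree-/ x (l ∨ r) = begin
  suc (degree (x / l) + degree r)        ≡⟨ cong (λ d → suc (d + degree r)) (degree-/ x l) ⟩
  suc (degree x + degree l + degree r)   ≡⟨ cong suc (+-assoc (degree x) (degree l) (degree r)) ⟩
  suc (degree x + (degree l + degree r)) ≡⟨ sym (+-suc (degree x) (degree l + degree r)) ⟩
  degree x + degree (l ∨ r)              ∎
  where open ≡-Reasoning

\\-identityʳ : ∀ x → x \\ leaf ≡ x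
\\-identityʳ leaf    = refl
\\-identityʳ (l ∨ r) = cong (l ∨_) (\\-identityʳ r)

-- Where the k-th leaf (counting from 0) lies relative to a subtree of degree d:
-- among its leaves (left), or the j-th leaf after it (right j).
data Side : Set where
  left  : Side
  right : ℕ → Side

locate : ℕ → ℕ → Side
locate zero    d       = left
locate (suc k) zero    = right k
locate (suc k) (suc d) = locate k d

locate-left : ∀ k d → locate k d ≡ left → k ≤ d
locate-left zero    d       _  = z≤n
locate-left (suc k) (suc d) eq = s≤s (locate-left k d eq)

locate-right : ∀ k d {j} → locate k d ≡ right j → k ≡ suc (d + j)
locate-right (suc k) zero    refl = refl
locate-right (suc k) (suc d) eq   = cong suc (locate-right k d eq)

locate-+ : ∀ k e → locate k (k + e) ≡ left
locate-+ zero    e = refl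
locate-+ (suc k) e = locate-+ k e

locate-suc-+ : ∀ d j → locate (suc (d + j)) d ≡ right j
locate-suc-+ zero    j = refl
locate-suc-+ (suc d) j = locate-suc-+ d j

thenLocate : Side → ℕ → Side
thenLocate left      e = left
thenLocate (right j) e = locate j e

locate-∨ : ∀ k d e → locate k (suc (d + e)) ≡ thenLocate (locate k d) e
locate-∨ zero    d       e = refl
locate-∨ (suc k) zero    e = refl
locate-∨ (suc k) (suc d) e = locate-∨ k d e

-- cut k z = (x , y) splits z at its k-th leaf: x spans the leaves 0..k of z and y those from k on.
cut : ℕ → Tree → Tree × Tree
cut k leaf = leaf , leaf
cut k (l ∨ r) with locate k (degree l)
... | left    = map₂ (_∨ r) (cut k l)
... | right j = map₁ (l ∨_) (cut j r)

cut-zero : ∀ t → cut 0 t ≡ (leaf , t)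
cut-zero leaf    = refl
cut-zero (l ∨ r) = cong (map₂ (_∨ r)) (cut-zero l)

cut-\\ : ∀ x y → cut (degree x) (x \\ y) ≡ (x , y)
cut-\\ leaf    y = cut-zero y
cut-\\ (l ∨ r) y rewrite locate-suc-+ (degree l) (degree r) = cong (map₁ (l ∨_)) (cut-\\ r y)

cut-/ : ∀ x y → cut (degree x) (x / y) ≡ (x , y)
cut-/ x leaf = subst (λ t → cut (degree x) t ≡ (x , leaf)) (\\-identityʳ x) (cut-\\ x leaf)
cut-/ x (l ∨ r) rewrite degree-/ x l | locate-+ (degree x) (degree l) = cong (map₂ (_∨ r)) (cut-/ x l)

cut-∈Sum : ∀ k z → z ∈Sum proj₁ (cut k z) , proj₂ (cut k z)
cut-∈Sum k leaf = refl≤ _ , refl≤ _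
cut-∈Sum k (l ∨ r) with locate k (degree l)
... | left    = let (lower , upper) = cut-∈Sum k l in
  congˡ r lower , trans≤ (congˡ r upper) (\\-∨-≤T (proj₁ (cut k l)) (proj₂ (cut k l)) r)
... | right j = let (lower , upper) = cut-∈Sum j r in
  trans≤ (∨-/-≤T l (proj₁ (cut j r)) (proj₂ (cut j r))) (congʳ l lower) , congʳ l upper

cut-degree : ∀ k z → k ≤ degree z → degree (proj₁ (cut k z)) ≡ k
cut-degree k leaf z≤n = refl
cut-degree k (l ∨ r) k≤z with locate k (degree l) in eq
... | left    = cut-degree k l (locate-left k (degree l) eq)
... | right j = trans (cong (λ d → suc (degree l + d)) (cut-degree j r j≤r)) (sym k≡)
  where
  k≡ : k ≡ suc (degree l + j)
  k≡ = locate-right k (degree l) eq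
  j≤r : j ≤ degree r
  j≤r = +-cancelˡ-≤ (degree l) j (degree r) (s≤s⁻¹ (subst (_≤ degree (l ∨ r)) k≡ k≤z))

_≤T²_ : Tree × Tree → Tree × Tree → Set
_≤T²_ = Pointwise _≤T_ _≤T_

cut-mono : ∀ k {a b} → a ≤T b → cut k a ≤T² cut k b
-- Reducing cut k ((a ∨ b) ∨ c) exposes a fresh copy of locate k (degree a), hence rewrite eqa.
cut-mono k (rot a b c) rewrite locate-∨ k (degree a) (degree b) with locate k (degree a) in eqa
... | left rewrite eqa = refl≤ _ , rot _ b c
... | right j with locate j (degree b)
...   | left    rewrite eqa = refl≤ _ , refl≤ _
...   | right i = rot a b _ , refl≤ _
cut-mono k (congˡ {a} {b} c p)
  with locate k (degree a) | locate k (degree b) | cong (locate k) (≤T-degree p)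
... | left    | _ | refl = proj₁ (cut-mono k p) , congˡ c (proj₂ (cut-mono k p))
... | right j | _ | refl = congˡ _ p , refl≤ _
cut-mono k (congʳ c p) with locate k (degree c)
... | left    = refl≤ _ , congʳ _ p
... | right j = congʳ c (proj₁ (cut-mono j p)) , proj₂ (cut-mono j p)
cut-mono k (refl≤ a)    = refl≤ _ , refl≤ _
cut-mono k (trans≤ p q) = trans≤ (proj₁ (cut-mono k p)) (proj₁ (cut-mono k q))
                        , trans≤ (proj₂ (cut-mono k p)) (proj₂ (cut-mono k q))

cut-unique : ∀ {n x y z} → degree x ≡ n → z ∈Sum x , y → cut n z ≡ (x , y)
cut-unique {x = x} {y} {z} refl (lower , upper) =
  ≡×≡⇒≡ (×-antisymmetric {R = _≤T_} {S = _≤T_} ≤T-antisym ≤T-antisym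
    (subst (cut (degree x) z ≤T²_) (cut-\\ x y) (cut-mono (degree x) upper))
    (subst (_≤T² cut (degree x) z) (cut-/ x y) (cut-mono (degree x) lower)))

proposition2p3 : (n m : ℕ) (z : Tree) → Y (n + m) z →
    Σ (Tree × Tree) (λ { (x , y) → (Y n x × Y m y) × (z ∈Sum x , y) })
    × ((x y x′ y′ : Tree) → Y n x → Y m y → z ∈Sum x , y →
        Y n x′ → Y m y′ → z ∈Sum x′ , y′ → (x ≡ x′) × (y ≡ y′))
proposition2p3 n m z deg-z = (cut n z , (deg-x , deg-y) , between) , unique
  where
  x y : Tree
  x = proj₁ (cut n z)
  y = proj₂ (cut n z)

  between : z ∈Sum x , y
  between = cut-∈Sum n z

  deg-x : degree x ≡ n
  deg-x = cut-degree n z (subst (n ≤_) (sym deg-z) (m≤m+n n m))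

  deg-y : degree y ≡ m
  deg-y = +-cancelˡ-≡ n (degree y) m (begin
    n + degree y         ≡⟨ cong (_+ degree y) (sym deg-x) ⟩
    degree x + degree y  ≡⟨ sym (degree-/ x y) ⟩
    degree (x / y)       ≡⟨ ≤T-degree (proj₁ between) ⟩
    degree z             ≡⟨ deg-z ⟩
    n + m                ∎)
    where open ≡-Reasoning

  unique : (x y x′ y′ : Tree) → Y n x → Y m y → z ∈Sum x , y →
           Y n x′ → Y m y′ → z ∈Sum x′ , y′ → (x ≡ x′) × (y ≡ y′)
  unique a b a′ b′ deg-a _ sum deg-a′ _ sum′ =
    ,-injective (trans (sym (cut-unique deg-a sum)) (cut-unique deg-a′ sum′))
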